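{- Let $d$ be any positive integer. The recursive formula for $r_d^{ -1}$ (given in the context) describes a function from $\mathbb{N}$ to $\mathbb{N}^d$, and $r_d(r_d^{ -1}(z))=z$ for all $z\in\mathbb{N}$.
   Context: $\mathbb{N}$ denotes the set of non-negative integers. The Rosenberg-Strong $d$-tupling function $r_d\colon\mathbb{N}^d\to\mathbb{N}$ is defined by $r_1(x_1)=x_1$ and, for $d>1$, $r_d(x_1,\ldots,x_{d-1},x_d)=r_{d-1}(x_1,\ldots,x_{d-1})+m^d+(m-x_d)\bigl((m+1)^{d-1}-m^{d-1}\bigr)$ with $m=\max(x_1,\ldots,x_d)$. The formula $r_d^{ -1}$ is defined recursively by $r_1^{ -1}(z)=z$ and, for integers $d>1$, $r_d^{ -1}(z)=\Bigl(r_{d-1}^{ -1}\bigl(z-m^d-(m-x_d)((m+1)^{d-1}-m^{d-1})\bigr),\,x_d\Bigr)$, where $m=\lfloor\sqrt[d]{z}\rfloor$ and $x_d=m-\left\lfloor\frac{\max(0,\,z-m^d-m^{d-1})}{(m+1)^{d-1}-m^{d-1}}\right\rfloor$; here $(\mathbf{v},x_d)$ with $\mathbf{v}=(v_1,\ldots,v_{d-1})$ denotes $(v_1,\ldots,v_{d-1},x_d)$. -}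

module Defs where

open import Data.Nat using (ℕ; zero; suc; _+_; _*_; _∸_; _^_; _⊔_; _≤ᵇ_)
open import Data.Nat.DivMod using (_/_)
open import Data.Bool using (if_then_else_)
open import Data.Vec using (Vec; []; _∷_; _∷ʳ_; init; last)

-- ⌊ z^(1/d) ⌋ for d ≥ 1: the largest m ≤ z with m ^ d ≤ z
-- (for d ≥ 1 the largest such m with m^d ≤ z is automatically ≤ z).
rootSearch : ℕ → ℕ → ℕ → ℕ
rootSearch d z zero    = zero
rootSearch d z (suc n) = if (suc n ^ d) ≤ᵇ z then suc n else rootSearch d z n

iroot : ℕ → ℕ → ℕ
iroot d z = rootSearch d z z

-- floor division; the divisor is shown positive in the statement whenever used
_div_ : ℕ → ℕ → ℕ
a div zero    = zero
a div (suc b) = a / suc b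

vmax : ∀ {n} → Vec ℕ n → ℕ
vmax []       = zero
vmax (x ∷ xs) = x ⊔ vmax xs

-- Rosenberg–Strong tupling function r_d with d = suc k
r : ∀ k → Vec ℕ (suc k) → ℕ
r zero    (x ∷ []) = x
r (suc k) xs =
  r k (init xs) + m ^ suc (suc k) + (m ∸ last xs) * (suc m ^ suc k ∸ m ^ suc k)
  where m = vmax xs

-- components of one step of the recursive formula for r_d^{-1}, d = suc (suc k)
-- m = ⌊ z^(1/d) ⌋
mStep : ℕ → ℕ → ℕ
mStep k z = iroot (suc (suc k)) z

denStep : ℕ → ℕ → ℕ
denStep k z = suc (mStep k z) ^ suc k ∸ mStep k z ^ suc k

qStep : ℕ → ℕ → ℕ
qStep k z = (z ∸ mStep k z ^ suc (suc k) ∸ mStep k z ^ suc k) div denStep k z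

xStep : ℕ → ℕ → ℕ
xStep k z = mStep k z ∸ qStep k z

subStep : ℕ → ℕ → ℕ
subStep k z = mStep k z ^ suc (suc k) + (mStep k z ∸ xStep k z) * denStep k z

-- the recursive formula r_d^{-1}, d = suc k (using truncated subtraction;
-- well-definedness over ℕ is part of the statement)
rinv : ∀ k → ℕ → Vec ℕ (suc k)
rinv zero    z = z ∷ []
rinv (suc k) z = rinv k (z ∸ subStep k z) ∷ʳ xStep k z

module Submission where

-- Write d = k + 2, m = ⌊z^{1/d}⌋, A = m^{d-1}, B = (m+1)^{d-1}
-- and D = B - A > 0.  Since m^d = m·A ≤ z < (m+1)·B, the part w = z - m^d
-- satisfies w < A + (m+1)·D.  The formula removes q = ⌊max(0, w - A)/D⌋
-- blocks of size D from w ("offset division"); hence q ≤ m, the remainder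
-- z' = w - q·D is below B (so ⌊z'^{1/(d-1)}⌋ ≤ m), and either z' ≥ A (so
-- ⌊z'^{1/(d-1)}⌋ = m) or q = 0 (so x_d = m - q = m).
--
-- By induction on d the maximum
-- of r_d^{-1}(z) is ⌊z^{1/d}⌋; with it, unfolding r_d on r_{d-1}^{-1}(z')
-- followed by x_d gives z' + m^d + q·D = z, again by induction.

open import Defs
open import Data.Nat
  using (ℕ; zero; suc; _+_; _*_; _∸_; _^_; _⊔_; _≤ᵇ_; _≤_; _<_; z≤n; s≤s; s≤s⁻¹; z<s; _≤?_)
open import Data.Nat.Properties
open import Data.Nat.DivMod using (_/_; _%_; m%n≡m∸m/n*n; m%n<n; m/n*n≤m; m<n*o⇒m/o<n; 0/n≡0)
open import Data.Nat.Tactic.RingSolver using (solve-∀)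
open import Data.Product using (_×_; _,_)
open import Data.Sum using (_⊎_; inj₁; inj₂)
open import Data.Bool using (true; false)
open import Data.Vec using (Vec; []; _∷_; _∷ʳ_)
open import Data.Vec.Properties using (init-∷ʳ; last-∷ʳ)
open import Relation.Nullary using (yes; no; ofʸ; ofⁿ)
open import Relation.Nullary.Negation using (contradiction)
open import Relation.Binary.PropositionalEquality
  using (_≡_; refl; sym; trans; cong; subst; subst₂; module ≡-Reasoning)

rootSearch-sound : ∀ e z n → rootSearch (suc e) z n ^ suc e ≤ z
rootSearch-sound e z zero = z≤n
rootSearch-sound e z (suc n) with (suc n ^ suc e) ≤ᵇ z | ≤ᵇ-reflects-≤ (suc n ^ suc e) z
... | true  | ofʸ p = p
... | false | ofⁿ _ = rootSearch-sound e z n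

rootSearch-maximal : ∀ e z n j → rootSearch (suc e) z n < j → j ≤ n → z < j ^ suc e
rootSearch-maximal e z zero j () z≤n
rootSearch-maximal e z (suc n) j lt j≤ with (suc n ^ suc e) ≤ᵇ z | ≤ᵇ-reflects-≤ (suc n ^ suc e) z
... | true  | ofʸ _ = contradiction j≤ (<⇒≱ lt)
... | false | ofⁿ ¬p with m≤n⇒m<n∨m≡n j≤
...   | inj₁ j<sn = rootSearch-maximal e z n j lt (s≤s⁻¹ j<sn)
...   | inj₂ refl = ≰⇒> ¬p

base≤power : ∀ n e → suc n ≤ suc n ^ suc e
base≤power n e = subst (_≤ suc n ^ suc e) (*-identityʳ (suc n)) (*-monoʳ-≤ (suc n) (m^n>0 (suc n) e))

iroot-below : ∀ e z → iroot (suc e) z ^ suc e ≤ z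
iroot-below e z = rootSearch-sound e z z

iroot-above : ∀ e z → z < suc (iroot (suc e) z) ^ suc e
iroot-above e z with suc (iroot (suc e) z) ≤? z
... | yes p = rootSearch-maximal e z z (suc (iroot (suc e) z)) ≤-refl p
... | no ¬p = <-≤-trans (s≤s (≮⇒≥ ¬p)) (base≤power (iroot (suc e) z) e)

iroot-bounded : ∀ e z m → z < suc m ^ suc e → iroot (suc e) z ≤ m
iroot-bounded e z m hi with iroot (suc e) z ≤? m
... | yes p = p
... | no ¬p = contradiction (≤-trans (^-monoˡ-≤ (suc e) (≰⇒> ¬p)) (iroot-below e z)) (<⇒≱ hi)

iroot-unique : ∀ e z m → m ^ suc e ≤ z → z < suc m ^ suc e → iroot (suc e) z ≡ m
iroot-unique e z m lo hi = ≤-antisym (iroot-bounded e z m hi) m≤root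
  where
  m≤root : m ≤ iroot (suc e) z
  m≤root with m ≤? iroot (suc e) z
  ... | yes p = p
  ... | no ¬p = contradiction (≤-trans (^-monoˡ-≤ (suc e) (≰⇒> ¬p)) lo) (<⇒≱ (iroot-above e z))

iroot-one : ∀ y → iroot 1 y ≡ y
iroot-one y = iroot-unique 0 y y (≤-reflexive (*-identityʳ y))
  (subst (y <_) (sym (*-identityʳ (suc y))) ≤-refl)

-- Offset division: from w remove q = ⌊max(0, w - A)/D⌋ blocks of size D > 0,
-- keeping a reserve A whenever w ≥ A.  (Truncated subtraction is max(0, ·).)

offset-quotient-zero : ∀ A {D} (D>0 : 0 < D) w → w ≤ A → (w ∸ A) div D ≡ 0
offset-quotient-zero A {suc D} z<s w w≤A = trans (cong (_/ suc D) (m≤n⇒m∸n≡0 w≤A)) (0/n≡0 (suc D))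

offset-remainder : ∀ A D w → A ≤ w → w ∸ (w ∸ A) / suc D * suc D ≡ A + (w ∸ A) % suc D
offset-remainder A D w A≤w = begin
  w ∸ q * suc D           ≡⟨ cong (_∸ q * suc D) (sym (m+[n∸m]≡n A≤w)) ⟩
  A + (w ∸ A) ∸ q * suc D ≡⟨ +-∸-assoc A (m/n*n≤m (w ∸ A) (suc D)) ⟩
  A + (w ∸ A ∸ q * suc D) ≡⟨ cong (A +_) (sym (m%n≡m∸m/n*n (w ∸ A) (suc D))) ⟩
  A + (w ∸ A) % suc D     ∎
  where
  open ≡-Reasoning
  q = (w ∸ A) / suc D

offset-removed≤ : ∀ A {D} (D>0 : 0 < D) w → (w ∸ A) div D * D ≤ w
offset-removed≤ A {suc D} z<s w = ≤-trans (m/n*n≤m (w ∸ A) (suc D)) (m∸n≤m w A)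

offset-quotient≤ : ∀ A {D} (D>0 : 0 < D) m w → w < A + suc m * D → (w ∸ A) div D ≤ m
offset-quotient≤ A {suc D} z<s m w lt = s≤s⁻¹ (m<n*o⇒m/o<n (m<n+o⇒m∸n<o w A lt))

offset-remainder< : ∀ A {D} (D>0 : 0 < D) w → w ∸ (w ∸ A) div D * D < A + D
offset-remainder< A {suc D} D>0@z<s w with A ≤? w
... | yes A≤w rewrite offset-remainder A D w A≤w = +-monoʳ-< A (m%n<n (w ∸ A) (suc D))
... | no A≰w rewrite offset-quotient-zero A D>0 w (<⇒≤ (≰⇒> A≰w)) =
  ≤-trans (≰⇒> A≰w) (m≤m+n A (suc D))

offset-reserve : ∀ A {D} (D>0 : 0 < D) w → A ≤ w ∸ (w ∸ A) div D * D ⊎ (w ∸ A) div D ≡ 0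
offset-reserve A {suc D} D>0@z<s w with A ≤? w
... | yes A≤w = inj₁ (≤-trans (m≤m+n A _) (≤-reflexive (sym (offset-remainder A D w A≤w))))
... | no A≰w  = inj₂ (offset-quotient-zero A D>0 w (<⇒≤ (≰⇒> A≰w)))

record StepFacts (k z : ℕ) : Set where
  field
    denominator-pos : 0 < denStep k z
    quotient≤root   : qStep k z ≤ mStep k z
    subtrahend≤z    : subStep k z ≤ z
    remainder<      : z ∸ subStep k z < suc (mStep k z) ^ suc k
    remainder-large : mStep k z ^ suc k ≤ z ∸ subStep k z ⊎ xStep k z ≡ mStep k z

-- If m·A + w < (m+1)·(A + D) = m·A + (A + (m+1)·D), then w < A + (m+1)·D:
-- the bound on w = z - m^d needed for offset division.
window : ∀ m A D w → m * A + w < suc m * (A + D) → w < A + suc m * D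
window m A D w lt = +-cancelˡ-< (m * A) w (A + suc m * D) (subst (m * A + w <_) (regroup m A D) lt)
  where
  regroup : ∀ m A D → suc m * (A + D) ≡ m * A + (A + suc m * D)
  regroup = solve-∀

-- Offset division of w = z - m^d with reserve A = m^{d-1} and block size
-- D = (m+1)^{d-1} - m^{d-1}, using m^d ≤ z < (m+1)^d from the root.
step-facts : ∀ k z → StepFacts k z
step-facts k z = record
  { denominator-pos = D>0
  ; quotient≤root   = q≤m
  ; subtrahend≤z    = subst (_≤ z) (sym sub≡) sub≤z
  ; remainder<      = subst (_< B) (sym rest≡) (subst (rest <_) A+D≡B (offset-remainder< A D>0 w))
  ; remainder-large = large (offset-reserve A D>0 w)
  }
  where
  open ≡-Reasoning
  m = mStep k z
  A = m ^ suc k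
  B = suc m ^ suc k
  D = denStep k z
  w = z ∸ m ^ suc (suc k)
  q = qStep k z
  rest = w ∸ q * D

  A<B : A < B
  A<B = ^-monoˡ-< (suc k) ≤-refl
  D>0 : 0 < D
  D>0 = m<n⇒0<n∸m A<B
  A+D≡B : A + D ≡ B
  A+D≡B = m+[n∸m]≡n (<⇒≤ A<B)
  z≡ : m ^ suc (suc k) + w ≡ z
  z≡ = m+[n∸m]≡n (iroot-below (suc k) z)

  q≤m : q ≤ m
  q≤m = offset-quotient≤ A D>0 m w (window m A D w
    (subst₂ _<_ (sym z≡) (cong (suc m *_) (sym A+D≡B)) (iroot-above (suc k) z)))

  -- since q ≤ m, the factor m - x_d = m - (m - q) is q itself
  sub≡ : subStep k z ≡ m ^ suc (suc k) + q * D
  sub≡ = cong (λ t → m ^ suc (suc k) + t * D) (m∸[m∸n]≡n q≤m)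

  sub≤z : m ^ suc (suc k) + q * D ≤ z
  sub≤z = subst (m ^ suc (suc k) + q * D ≤_) z≡ (+-monoʳ-≤ (m ^ suc (suc k)) (offset-removed≤ A D>0 w))

  rest≡ : z ∸ subStep k z ≡ rest
  rest≡ = begin
    z ∸ subStep k z                    ≡⟨ cong (z ∸_) sub≡ ⟩
    z ∸ (m ^ suc (suc k) + q * D)      ≡⟨ sym (∸-+-assoc z (m ^ suc (suc k)) (q * D)) ⟩
    rest                               ∎

  large : A ≤ rest ⊎ q ≡ 0 → A ≤ z ∸ subStep k z ⊎ xStep k z ≡ m
  large (inj₁ A≤rest) = inj₁ (subst (A ≤_) (sym rest≡) A≤rest)
  large (inj₂ q≡0)    = inj₂ (cong (m ∸_) q≡0)

step-max : ∀ k z → iroot (suc k) (z ∸ subStep k z) ⊔ xStep k z ≡ mStep k z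
step-max k z = combine remainder-large
  where
  open StepFacts (step-facts k z)
  m = mStep k z
  x = xStep k z
  z' = z ∸ subStep k z

  combine : m ^ suc k ≤ z' ⊎ x ≡ m → iroot (suc k) z' ⊔ x ≡ m
  combine (inj₁ lo)  = trans (cong (_⊔ x) (iroot-unique k z' m lo remainder<))
                             (m≥n⇒m⊔n≡m (m∸n≤m m (qStep k z)))
  combine (inj₂ x≡m) = trans (cong (iroot (suc k) z' ⊔_) x≡m)
                             (m≤n⇒m⊔n≡n (iroot-bounded k z' m remainder<))

vmax-∷ʳ : ∀ {n} (v : Vec ℕ n) x → vmax (v ∷ʳ x) ≡ vmax v ⊔ x
vmax-∷ʳ []      x = ⊔-identityʳ x
vmax-∷ʳ (y ∷ v) x = trans (cong (y ⊔_) (vmax-∷ʳ v x)) (sym (⊔-assoc y (vmax v) x))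

vmax-rinv : ∀ k z → vmax (rinv k z) ≡ iroot (suc k) z
vmax-rinv zero    z = trans (⊔-identityʳ z) (sym (iroot-one z))
vmax-rinv (suc k) z = begin
  vmax (rinv k z' ∷ʳ xStep k z)           ≡⟨ vmax-∷ʳ (rinv k z') (xStep k z) ⟩
  vmax (rinv k z') ⊔ xStep k z            ≡⟨ cong (_⊔ xStep k z) (vmax-rinv k z') ⟩
  iroot (suc k) z' ⊔ xStep k z            ≡⟨ step-max k z ⟩
  mStep k z                               ∎
  where
  open ≡-Reasoning
  z' = z ∸ subStep k z

r-∷ʳ : ∀ k (v : Vec ℕ (suc k)) x →
  r (suc k) (v ∷ʳ x) ≡ r k v + vmax (v ∷ʳ x) ^ suc (suc k)
                        + (vmax (v ∷ʳ x) ∸ x) * (suc (vmax (v ∷ʳ x)) ^ suc k ∸ vmax (v ∷ʳ x) ^ suc k)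
r-∷ʳ k v x rewrite init-∷ʳ x v | last-∷ʳ x v = refl

r-rinv : ∀ k z → r k (rinv k z) ≡ z
r-rinv zero    z = refl
r-rinv (suc k) z = begin
  r (suc k) (rinv k z' ∷ʳ xStep k z)
    ≡⟨ r-∷ʳ k (rinv k z') (xStep k z) ⟩
  r k (rinv k z') + M ^ suc (suc k) + (M ∸ xStep k z) * (suc M ^ suc k ∸ M ^ suc k)
    ≡⟨ cong (λ t → r k (rinv k z') + t ^ suc (suc k) + (t ∸ xStep k z) * (suc t ^ suc k ∸ t ^ suc k))
            (vmax-rinv (suc k) z) ⟩
  r k (rinv k z') + mStep k z ^ suc (suc k) + (mStep k z ∸ xStep k z) * denStep k z
    ≡⟨ cong (λ t → t + mStep k z ^ suc (suc k) + (mStep k z ∸ xStep k z) * denStep k z) (r-rinv k z') ⟩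
  z' + mStep k z ^ suc (suc k) + (mStep k z ∸ xStep k z) * denStep k z
    ≡⟨ +-assoc z' (mStep k z ^ suc (suc k)) _ ⟩
  z' + subStep k z
    ≡⟨ m∸n+n≡m (StepFacts.subtrahend≤z (step-facts k z)) ⟩
  z ∎
  where
  open ≡-Reasoning
  z' = z ∸ subStep k z
  M = vmax (rinv k z' ∷ʳ xStep k z)

lemma15 : (k z : ℕ) →
    ((0 < denStep k z) × (qStep k z ≤ mStep k z) × (subStep k z ≤ z))
    × r k (rinv k z) ≡ z
lemma15 k z = (denominator-pos , quotient≤root , subtrahend≤z) , r-rinv k z
  where open StepFacts (step-facts k z)
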